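{- Let $n\ge 2$. The rewriting relation $\rightarrowtail_{\mathrm{full}}$ on head normal forms, generated by the rules below (applied to subterms), is terminating and confluent. Here $x,x'$ range over variables and $y,y_i,z_j$ over head normal forms, and $1\le i\le n$: $(r_2)$ $q(x,y,\dots,y)\rightarrowtail y$; $(r_3)$ $q(x,\mathsf e_1,\dots,\mathsf e_n)\rightarrowtail x$; $(r_4^i)$ $q(x,y_1,\dots,y_{i-1},x,y_{i+1},\dots,y_n)\rightarrowtail q(x,y_1,\dots,y_{i-1},\mathsf e_i,y_{i+1},\dots,y_n)$; $(r_5^i)$ $q(x,y_1,\dots,y_{i-1},q(x,z_1,\dots,z_n),y_{i+1},\dots,y_n)\rightarrowtail q(x,y_1,\dots,y_{i-1},z_i,y_{i+1},\dots,y_n)$; $(r_6^i)$ if $x'<x$: $q(x,y_1,\dots,y_{i-1},q(x',z_1,\dots,z_n),y_{i+1},\dots,y_n)\rightarrowtail q(x',q(x,y_1,\dots,y_{i-1},z_1,y_{i+1},\dots,y_n),\dots,q(x,y_1,\dots,y_{i-1},z_n,y_{i+1},\dots,y_n))$; $(r_7^i)$ if $x'<x$: $q(x,y_1,\dots,y_{i-1},x',y_{i+1},\dots,y_n)\rightarrowtail q(x',q(x,y_1,\dots,y_{i-1},\mathsf e_1,y_{i+1},\dots,y_n),\dots,q(x,y_1,\dots,y_{i-1},\mathsf e_n,y_{i+1},\dots,y_n))$.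
   Context: $\nu_n$ is the type with one $(n+1)$-ary symbol $q$ and constants $\mathsf e_1,\dots,\mathsf e_n$. The variables are $x_1,x_2,x_3,\dots$, totally ordered by $x_1<x_2<x_3<\cdots$. Head normal forms are the $\nu_n$-terms generated by the grammar $t,t_i::=\mathsf e_i\mid x\mid q(x,t_1,\dots,t_n)$ with $x$ a variable (so the first argument of every occurrence of $q$ is a variable). Terminating means there is no infinite rewrite sequence; confluent means any two terms reachable from a common term by rewriting can be rewritten to a common term. -}

module Defs where

open import Data.Nat using (ℕ; _<_)
open import Data.Fin using (Fin)
open import Data.Vec using (Vec; lookup; replicate; tabulate; map; _[_]≔_)
open import Data.Product using (∃; _×_)
open import Relation.Binary.PropositionalEquality using (_≡_)
open import Relation.Binary.Construct.Closure.ReflexiveTransitive using (Star)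
open import Relation.Nullary using (¬_)

Var : Set
Var = ℕ

data HNF (n : ℕ) : Set where
  e   : Fin n → HNF n
  var : Var → HNF n
  q   : Var → Vec (HNF n) n → HNF n

data _↣_ {n : ℕ} : HNF n → HNF n → Set where
  r2  : ∀ x y → q x (replicate n y) ↣ y
  r3  : ∀ x → q x (tabulate e) ↣ var x
  r4  : ∀ x (ys : Vec (HNF n) n) i →
        lookup ys i ≡ var x →
        q x ys ↣ q x (ys [ i ]≔ e i)
  r5  : ∀ x (ys zs : Vec (HNF n) n) i →
        lookup ys i ≡ q x zs →
        q x ys ↣ q x (ys [ i ]≔ lookup zs i)
  r6  : ∀ x x′ (ys zs : Vec (HNF n) n) i → x′ < x →
        lookup ys i ≡ q x′ zs →
        q x ys ↣ q x′ (map (λ z → q x (ys [ i ]≔ z)) zs)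
  r7  : ∀ x x′ (ys : Vec (HNF n) n) i → x′ < x →
        lookup ys i ≡ var x′ →
        q x ys ↣ q x′ (tabulate (λ j → q x (ys [ i ]≔ e j)))
  cong-q : ∀ x (ys : Vec (HNF n) n) i {t} →
        lookup ys i ↣ t →
        q x ys ↣ q x (ys [ i ]≔ t)

_↣*_ : ∀ {n} → HNF n → HNF n → Set
_↣*_ = Star _↣_

Terminating : ∀ {n} → Set
Terminating {n} = ¬ (∃ λ (f : ℕ → HNF n) → ∀ k → f k ↣ f (ℕ.suc k))

Confluent : ∀ {n} → Set
Confluent {n} = ∀ (t u v : HNF n) → t ↣* u → t ↣* v → ∃ λ w → (u ↣* w) × (v ↣* w)

module Submission where

-- A term q x ys is strongly normalising (SN) as soon as its arguments are:
-- induction on the head variable x (r6, r7 lower the head variable) and, inside, on the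
-- argument vector under "one argument gets smaller", where an argument may shrink to a
-- reduct, to one of its own arguments (r5, r6) or from a variable to a constant (r4, r7).
-- This order on arguments is well founded on SN terms; induction on terms gives SN for all.
--
-- Under an environment ρ of indices, q x ys denotes its (ρ x)-th argument, and
-- every rule preserves this value.  In a normal form q x ys all arguments mention only
-- variables above x, so argument i has the value of the whole term with x set to i.  For
-- n ≥ 2 two normal forms with the same value therefore coincide (otherwise the arguments
-- would all be equal, an r2-redex, or be e_1, …, e_n, an r3-redex).  Every term has a
-- normal form, so two reducts of t reach normal forms with the value of t: the same one.

open import Defs
open import Data.Nat using (ℕ; _≤_)
open import Data.Product using (_×_)

open import Data.Nat as ℕ using (zero; suc; _+_; _<_; _<?_; s≤s; z≤n)
open import Data.Nat.Properties using (<-cmp; <-irrefl; <-trans; <-≤-trans; +-monoˡ-<; +-mono-<;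
  +-comm; ≤-reflexive; ≤-trans; m≤m+n; m≤n+m; n<1+n)
open import Data.Nat.Induction using (<-wellFounded)
open import Data.Fin using (Fin; zero; suc)
open import Data.Fin.Properties using (any?; all?; ¬∀⟶∃¬) renaming (_≟_ to _≟ᶠ_)
open import Data.Vec using (Vec; []; _∷_; lookup; replicate; tabulate; map; _[_]≔_)
open import Data.Vec.Properties using (lookup∘update; lookup∘update′; lookup-map; lookup-replicate;
  lookup∘tabulate; tabulate∘lookup; tabulate-cong; ≡-dec)
open import Data.Product using (∃; _,_; uncurry)
open import Data.Unit using (⊤; tt)
open import Data.Empty using (⊥; ⊥-elim)
open import Function using (_∘_)
open import Induction.WellFounded using (Acc; acc; acc-inverse; WfRec)
open import Relation.Binary using (tri<; tri≈; tri>)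
open import Relation.Binary.PropositionalEquality
open import Relation.Binary.Construct.Closure.ReflexiveTransitive using (ε; _◅_; _◅◅_)
open import Relation.Nullary using (¬_; Dec; yes; no)
open import Relation.Nullary.Decidable using (map′; _×-dec_; decidable-stable)
open ≡-Reasoning

vec-ext : ∀ {A : Set} {k} (xs ys : Vec A k) → (∀ i → lookup xs i ≡ lookup ys i) → xs ≡ ys
vec-ext xs ys same = begin
  xs                   ≡⟨ sym (tabulate∘lookup xs) ⟩
  tabulate (lookup xs) ≡⟨ tabulate-cong same ⟩
  tabulate (lookup ys) ≡⟨ tabulate∘lookup ys ⟩
  ys                   ∎

update-∀ : ∀ {A : Set} {P : A → Set} {k} (xs : Vec A k) i {y} →
           (∀ j → P (lookup xs j)) → P y → ∀ j → P (lookup (xs [ i ]≔ y) j)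
update-∀ {P = P} xs i {y} all-P Py j with j ≟ᶠ i
... | yes refl = subst P (sym (lookup∘update j xs y)) Py
... | no j≢i   = subst P (sym (lookup∘update′ j≢i xs y)) (all-P j)

data OnePosition {A : Set} (_<′_ : A → A → Set) {k} : Vec A k → Vec A k → Set where
  at : ∀ ys i {y} → y <′ lookup ys i → OnePosition _<′_ (ys [ i ]≔ y) ys

-- Lexicographic-style induction: decreasing the head, or the tail with the head fixed.
∷-acc : ∀ {A : Set} {_<′_ : A → A → Set} {k} {y : A} {ys : Vec A k} →
        Acc _<′_ y → Acc (OnePosition _<′_) ys → Acc (OnePosition _<′_) (y ∷ ys)
∷-acc acc-y@(acc below) acc-ys@(acc smaller) = acc λ
  { (at _ zero y′<y)     → ∷-acc (below y′<y) acc-ys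
  ; (at _ (suc i) y′<yᵢ) → ∷-acc acc-y (smaller (at _ i y′<yᵢ)) }

onePosition-acc : ∀ {A : Set} {_<′_ : A → A → Set} {k} (ys : Vec A k) →
                  (∀ i → Acc _<′_ (lookup ys i)) → Acc (OnePosition _<′_) ys
onePosition-acc []       _    = acc λ { (at _ () _) }
onePosition-acc (y ∷ ys) accs = ∷-acc (accs zero) (onePosition-acc ys (accs ∘ suc))

module _ {n : ℕ} where

  hnf-ind : (P : HNF n → Set) → (∀ i → P (e i)) → (∀ x → P (var x)) →
            (∀ x ys → (∀ i → P (lookup ys i)) → P (q x ys)) → ∀ t → P t
  hnf-ind P Pe Pvar Pq = go
    where
    go  : ∀ t → P t
    go* : ∀ {k} (ys : Vec (HNF n) k) i → P (lookup ys i)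
    go (e i)    = Pe i
    go (var x)  = Pvar x
    go (q x ys) = Pq x ys (go* ys)
    go* (y ∷ ys) zero    = go y
    go* (y ∷ ys) (suc i) = go* ys i

  _≟_ : (s t : HNF n) → Dec (s ≡ t)
  _≟_ = hnf-ind (λ s → ∀ t → Dec (s ≡ t)) ≟-e ≟-var ≟-q
    where
    ≟-e : ∀ i t → Dec (e i ≡ t)
    ≟-e i (e j)   = map′ (cong e) (λ { refl → refl }) (i ≟ᶠ j)
    ≟-e i (var _) = no λ ()
    ≟-e i (q _ _) = no λ ()
    ≟-var : ∀ x t → Dec (var x ≡ t)
    ≟-var x (var y) = map′ (cong var) (λ { refl → refl }) (x ℕ.≟ y)
    ≟-var x (e _)   = no λ ()
    ≟-var x (q _ _) = no λ ()
    ≟-q : ∀ x ys → (∀ i t → Dec (lookup ys i ≡ t)) → ∀ t → Dec (q x ys ≡ t)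
    ≟-q x ys args≟ (q y zs) =
      map′ (λ (x≡y , same) → cong₂ q x≡y (vec-ext ys zs same)) (λ { refl → refl , λ _ → refl })
           ((x ℕ.≟ y) ×-dec all? (λ i → args≟ i (lookup zs i)))
    ≟-q x ys args≟ (e _)   = no λ ()
    ≟-q x ys args≟ (var _) = no λ ()

  Reducible Normal : HNF n → Set
  Reducible t = ∃ λ t′ → t ↣ t′
  Normal t    = ¬ Reducible t

  e-normal : ∀ {i} → Normal (e i)
  e-normal (_ , ())

  var-normal : ∀ {x} → Normal (var x)
  var-normal (_ , ())

  arg-normal : ∀ {x ys} → Normal (q x ys) → ∀ i → Normal (lookup ys i)
  arg-normal {x} {ys} nf i (_ , step) = nf (_ , cong-q x ys i step)

  -- HeadAbove x t: the head symbol of t is a constant or a variable above x.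
  -- Exactly these arguments of q x escape the rules r4–r7.
  HeadAbove : Var → HNF n → Set
  HeadAbove x (e _)   = ⊤
  HeadAbove x (var y) = x < y
  HeadAbove x (q y _) = x < y

  headAbove? : ∀ x t → Dec (HeadAbove x t)
  headAbove? x (e _)   = yes tt
  headAbove? x (var y) = x <? y
  headAbove? x (q y _) = x <? y

  redex : ∀ x ys i {c} → lookup ys i ≡ c → ¬ HeadAbove x c → Reducible (q x ys)
  redex x ys i {e _} _ ¬above = ⊥-elim (¬above tt)
  redex x ys i {var y} yᵢ≡y ¬above with <-cmp x y
  ... | tri< x<y _ _  = ⊥-elim (¬above x<y)
  ... | tri≈ _ refl _ = _ , r4 x ys i yᵢ≡y
  ... | tri> _ _ y<x  = _ , r7 x y ys i y<x yᵢ≡y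
  redex x ys i {q y zs} yᵢ≡q ¬above with <-cmp x y
  ... | tri< x<y _ _  = ⊥-elim (¬above x<y)
  ... | tri≈ _ refl _ = _ , r5 x ys zs i yᵢ≡q
  ... | tri> _ _ y<x  = _ , r6 x y ys zs i y<x yᵢ≡q

  normal-q : ∀ x ys → (∀ i → Normal (lookup ys i)) → (∀ i → HeadAbove x (lookup ys i)) →
             (∀ y → ys ≢ replicate n y) → ys ≢ tabulate e → Normal (q x ys)
  normal-q x _  _ _ ¬r2 _ (_ , r2 _ y) = ¬r2 y refl
  normal-q x _  _ _ _ ¬r3 (_ , r3 _)   = ¬r3 refl
  normal-q x ys _ above _ _ (_ , r4 _ _ i yᵢ≡x) =
    <-irrefl refl (subst (HeadAbove x) yᵢ≡x (above i))
  normal-q x ys _ above _ _ (_ , r5 _ _ zs i yᵢ≡q) =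
    <-irrefl refl (subst (HeadAbove x) yᵢ≡q (above i))
  normal-q x ys _ above _ _ (_ , r6 _ x′ _ zs i x′<x yᵢ≡q) =
    <-irrefl refl (<-trans (subst (HeadAbove x) yᵢ≡q (above i)) x′<x)
  normal-q x ys _ above _ _ (_ , r7 _ x′ _ i x′<x yᵢ≡x′) =
    <-irrefl refl (<-trans (subst (HeadAbove x) yᵢ≡x′ (above i)) x′<x)
  normal-q x ys args _ _ _ (_ , cong-q _ _ i step) = args i (_ , step)

  -- Strong normalisation, and the order on arguments used to prove it.

  data _⊴_ : HNF n → HNF n → Set where
    here  : ∀ {s} → s ⊴ s
    there : ∀ {t x ys} i → t ⊴ lookup ys i → t ⊴ q x ys

  ⊴-trans : ∀ {u t s} → u ⊴ t → t ⊴ s → u ⊴ s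
  ⊴-trans u⊴t here          = u⊴t
  ⊴-trans u⊴t (there i t⊴s) = there i (⊴-trans u⊴t t⊴s)

  ⊴-step : ∀ {t s u} → t ⊴ s → t ↣ u → ∃ λ s′ → s ↣ s′ × u ⊴ s′
  ⊴-step here step = _ , step , here
  ⊴-step {u = u} (there {x = x} {ys} i t⊴yᵢ) step =
    let s′ , yᵢ↣s′ , u⊴s′ = ⊴-step t⊴yᵢ step
    in  q x (ys [ i ]≔ s′) , cong-q x ys i yᵢ↣s′ ,
        there i (subst (u ⊴_) (sym (lookup∘update i ys s′)) u⊴s′)

  _↢_ : HNF n → HNF n → Set
  t ↢ s = s ↣ t

  SN : HNF n → Set
  SN = Acc _↢_

  normal⇒SN : ∀ {t} → Normal t → SN t
  normal⇒SN nf = acc λ step → ⊥-elim (nf (_ , step))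

  SN-⊴ : ∀ {s t} → SN s → t ⊴ s → SN t
  SN-⊴ (acc reducts) t⊴s = acc λ step →
    let _ , s↣s′ , u⊴s′ = ⊴-step t⊴s step in SN-⊴ (reducts s↣s′) u⊴s′

  SN-arg : ∀ {x ys} → SN (q x ys) → ∀ i → SN (lookup ys i)
  SN-arg sn i = SN-⊴ sn (there i here)

  SN⇒finite : ∀ {t} → SN t → (f : ℕ → HNF n) → f 0 ≡ t → ¬ (∀ k → f k ↣ f (suc k))
  SN⇒finite (acc reducts) f refl steps =
    SN⇒finite (reducts (steps 0)) (f ∘ suc) refl (steps ∘ suc)

  data _≺_ : HNF n → HNF n → Set where
    reduct : ∀ {s t} → s ↣ t → t ≺ s
    arg    : ∀ x ys i → lookup ys i ≺ q x ys
    e≺var  : ∀ i x → e i ≺ var x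

  e-acc : ∀ {i} → Acc _≺_ (e i)
  e-acc = acc λ { (reduct ()) }

  subterm-acc : ∀ {s} → SN s → ∀ t → t ⊴ s → Acc _≺_ t
  subterm-acc {s} (acc reducts) = hnf-ind (λ t → t ⊴ s → Acc _≺_ t) (λ _ _ → e-acc) var-acc q-acc
    where
    via-step : ∀ {t u} → t ⊴ s → t ↣ u → Acc _≺_ u
    via-step t⊴s step = let _ , s↣s′ , u⊴s′ = ⊴-step t⊴s step
                        in  subterm-acc (reducts s↣s′) _ u⊴s′
    var-acc : ∀ x → var x ⊴ s → Acc _≺_ (var x)
    var-acc x x⊴s = acc λ { (reduct step) → via-step x⊴s step ; (e≺var _ _) → e-acc }
    q-acc : ∀ x ys → (∀ i → lookup ys i ⊴ s → Acc _≺_ (lookup ys i)) → q x ys ⊴ s → Acc _≺_ (q x ys)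
    q-acc x ys args q⊴s = acc λ
      { (reduct step) → via-step q⊴s step
      ; (arg _ _ i)   → args i (⊴-trans (there i here) q⊴s) }

  SN⇒acc : ∀ {t} → SN t → Acc _≺_ t
  SN⇒acc sn = subterm-acc sn _ here

  -- Semantics: under ρ, q x ys selects its (ρ x)-th argument; rewriting preserves values.

  Env : Set
  Env = Var → Fin n

  _[_↦_] : Env → Var → Fin n → Env
  (ρ [ x ↦ i ]) y with y ℕ.≟ x
  ... | yes _ = i
  ... | no _  = ρ y

  [↦]-same : ∀ ρ x i → (ρ [ x ↦ i ]) x ≡ i
  [↦]-same ρ x i with x ℕ.≟ x
  ... | yes _   = refl
  ... | no x≢x  = ⊥-elim (x≢x refl)

  [↦]-other : ∀ ρ x i {y} → y ≢ x → (ρ [ x ↦ i ]) y ≡ ρ y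
  [↦]-other ρ x i {y} y≢x with y ℕ.≟ x
  ... | yes y≡x = ⊥-elim (y≢x y≡x)
  ... | no _    = refl

  ⟦_⟧ : HNF n → Env → Fin n
  ⟦_⟧* : ∀ {k} → Vec (HNF n) k → Env → Vec (Fin n) k
  ⟦ e i ⟧ ρ    = i
  ⟦ var x ⟧ ρ  = ρ x
  ⟦ q x ys ⟧ ρ = lookup (⟦ ys ⟧* ρ) (ρ x)
  ⟦ [] ⟧* ρ     = []
  ⟦ y ∷ ys ⟧* ρ = ⟦ y ⟧ ρ ∷ ⟦ ys ⟧* ρ

  lookup-⟦⟧* : ∀ {k} (ys : Vec (HNF n) k) i ρ → lookup (⟦ ys ⟧* ρ) i ≡ ⟦ lookup ys i ⟧ ρ
  lookup-⟦⟧* (y ∷ ys) zero    ρ = refl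
  lookup-⟦⟧* (y ∷ ys) (suc i) ρ = lookup-⟦⟧* ys i ρ

  ⟦q⟧ : ∀ x ys ρ → ⟦ q x ys ⟧ ρ ≡ ⟦ lookup ys (ρ x) ⟧ ρ
  ⟦q⟧ x ys ρ = lookup-⟦⟧* ys (ρ x) ρ

  ⟦≡⟧ : ∀ {s t} ρ → s ≡ t → ⟦ s ⟧ ρ ≡ ⟦ t ⟧ ρ
  ⟦≡⟧ ρ = cong (λ u → ⟦ u ⟧ ρ)

  _≈_ : HNF n → HNF n → Set
  s ≈ t = ∀ ρ → ⟦ s ⟧ ρ ≡ ⟦ t ⟧ ρ

  ≈-sym : ∀ {s t} → s ≈ t → t ≈ s
  ≈-sym s≈t ρ = sym (s≈t ρ)


  ⟦update⟧ : ∀ x ys i t ρ → (ρ x ≡ i → ⟦ lookup ys i ⟧ ρ ≡ ⟦ t ⟧ ρ) →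
             ⟦ q x ys ⟧ ρ ≡ ⟦ q x (ys [ i ]≔ t) ⟧ ρ
  ⟦update⟧ x ys i t ρ selected with ρ x ≟ᶠ i
  ... | yes refl = begin
    ⟦ q x ys ⟧ ρ                      ≡⟨ ⟦q⟧ x ys ρ ⟩
    ⟦ lookup ys (ρ x) ⟧ ρ             ≡⟨ selected refl ⟩
    ⟦ t ⟧ ρ                           ≡⟨ ⟦≡⟧ ρ (sym (lookup∘update (ρ x) ys t)) ⟩
    ⟦ lookup (ys [ i ]≔ t) (ρ x) ⟧ ρ ≡⟨ sym (⟦q⟧ x (ys [ i ]≔ t) ρ) ⟩
    ⟦ q x (ys [ i ]≔ t) ⟧ ρ           ∎
  ... | no ρx≢i = begin
    ⟦ q x ys ⟧ ρ                      ≡⟨ ⟦q⟧ x ys ρ ⟩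
    ⟦ lookup ys (ρ x) ⟧ ρ             ≡⟨ ⟦≡⟧ ρ (sym (lookup∘update′ ρx≢i ys t)) ⟩
    ⟦ lookup (ys [ i ]≔ t) (ρ x) ⟧ ρ ≡⟨ sym (⟦q⟧ x (ys [ i ]≔ t) ρ) ⟩
    ⟦ q x (ys [ i ]≔ t) ⟧ ρ           ∎

  sound : ∀ {s t} → s ↣ t → s ≈ t
  sound (r2 x y) ρ = trans (⟦q⟧ x (replicate n y) ρ) (⟦≡⟧ ρ (lookup-replicate (ρ x) y))
  sound (r3 x)   ρ = trans (⟦q⟧ x (tabulate e) ρ) (⟦≡⟧ ρ (lookup∘tabulate e (ρ x)))
  sound (r4 x ys i yᵢ≡x) ρ = ⟦update⟧ x ys i (e i) ρ (trans (⟦≡⟧ ρ yᵢ≡x))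
  sound (r5 x ys zs i yᵢ≡q) ρ = ⟦update⟧ x ys i (lookup zs i) ρ λ ρx≡i →
    trans (⟦≡⟧ ρ yᵢ≡q) (trans (⟦q⟧ x zs ρ) (cong (λ j → ⟦ lookup zs j ⟧ ρ) ρx≡i))
  sound (r6 x x′ ys zs i _ yᵢ≡q) ρ =
    trans (⟦update⟧ x ys i (lookup zs (ρ x′)) ρ (λ _ → trans (⟦≡⟧ ρ yᵢ≡q) (⟦q⟧ x′ zs ρ)))
          (sym (trans (⟦q⟧ x′ (map f zs) ρ) (⟦≡⟧ ρ (lookup-map (ρ x′) f zs))))
    where f = λ z → q x (ys [ i ]≔ z)
  sound (r7 x x′ ys i _ yᵢ≡x′) ρ =
    trans (⟦update⟧ x ys i (e (ρ x′)) ρ (λ _ → ⟦≡⟧ ρ yᵢ≡x′))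
          (sym (trans (⟦q⟧ x′ (tabulate f) ρ) (⟦≡⟧ ρ (lookup∘tabulate f (ρ x′)))))
    where f = λ j → q x (ys [ i ]≔ e j)
  sound (cong-q x ys i step) ρ = ⟦update⟧ x ys i _ ρ (λ _ → sound step ρ)

  sound* : ∀ {s t} → s ↣* t → s ≈ t
  sound* ε              ρ = refl
  sound* (step ◅ steps) ρ = trans (sound step ρ) (sound* steps ρ)

  reducts-≈ : ∀ {t u v} → t ↣* u → t ↣* v → u ≈ v
  reducts-≈ t↣*u t↣*v ρ = trans (sym (sound* t↣*u ρ)) (sound* t↣*v ρ)

  -- Normal forms: arguments lie above the head variable, so their values are determined.

  data Above (x : Var) : HNF n → Set where
    e↑   : ∀ {i} → Above x (e i)
    var↑ : ∀ {y} → x < y → Above x (var y)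
    q↑   : ∀ {y zs} → x < y → (∀ j → Above x (lookup zs j)) → Above x (q y zs)

  Above-weaken : ∀ {x′ x t} → x′ < x → Above x t → Above x′ t
  Above-weaken x′<x e↑             = e↑
  Above-weaken x′<x (var↑ x<y)     = var↑ (<-trans x′<x x<y)
  Above-weaken x′<x (q↑ x<y above) = q↑ (<-trans x′<x x<y) (Above-weaken x′<x ∘ above)

  Invariant : Var → HNF n → Set
  Invariant x t = ∀ ρ i → ⟦ t ⟧ (ρ [ x ↦ i ]) ≡ ⟦ t ⟧ ρ

  Above⇒Invariant : ∀ {x t} → Above x t → Invariant x t
  Above⇒Invariant e↑ ρ i = refl
  Above⇒Invariant {x} (var↑ x<y) ρ i = [↦]-other ρ x i (λ y≡x → <-irrefl (sym y≡x) x<y)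
  Above⇒Invariant {x} (q↑ {y} {zs} x<y above) ρ i = begin
    ⟦ q y zs ⟧ ρ′           ≡⟨ ⟦q⟧ y zs ρ′ ⟩
    ⟦ lookup zs (ρ′ y) ⟧ ρ′ ≡⟨ cong (λ j → ⟦ lookup zs j ⟧ ρ′) ρ′y≡ρy ⟩
    ⟦ lookup zs (ρ y) ⟧ ρ′  ≡⟨ Above⇒Invariant (above (ρ y)) ρ i ⟩
    ⟦ lookup zs (ρ y) ⟧ ρ   ≡⟨ sym (⟦q⟧ y zs ρ) ⟩
    ⟦ q y zs ⟧ ρ            ∎
    where
    ρ′ = ρ [ x ↦ i ]
    ρ′y≡ρy : ρ′ y ≡ ρ y
    ρ′y≡ρy = [↦]-other ρ x i (λ y≡x → <-irrefl (sym y≡x) x<y)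

  ArgsAbove : HNF n → Set
  ArgsAbove (q x ys) = ∀ i → Above x (lookup ys i)
  ArgsAbove _        = ⊤

  HeadAbove⇒Above : ∀ {x} t → HeadAbove x t → ArgsAbove t → Above x t
  HeadAbove⇒Above (e _)    _   _    = e↑
  HeadAbove⇒Above (var _)  x<y _    = var↑ x<y
  HeadAbove⇒Above (q _ _)  x<y args = q↑ x<y (Above-weaken x<y ∘ args)

  -- In a normal form q x ys every argument is headed above x (else r4–r7 apply) …
  normal⇒HeadAbove : ∀ {x ys} → Normal (q x ys) → ∀ i → HeadAbove x (lookup ys i)
  normal⇒HeadAbove {x} {ys} nf i =
    decidable-stable (headAbove? x (lookup ys i)) (λ ¬above → nf (redex x ys i refl ¬above))

  normal⇒ArgsAbove : ∀ t → Normal t → ArgsAbove t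
  normal⇒ArgsAbove = hnf-ind (λ t → Normal t → ArgsAbove t) (λ _ _ → tt) (λ _ _ → tt)
    λ x ys ih nf i → HeadAbove⇒Above (lookup ys i) (normal⇒HeadAbove nf i) (ih i (arg-normal nf i))

  normal⇒Above : ∀ {x t} → HeadAbove x t → Normal t → Above x t
  normal⇒Above {t = t} head nf = HeadAbove⇒Above t head (normal⇒ArgsAbove t nf)

  arg-value : ∀ {x ys} → Normal (q x ys) → ∀ i ρ → ⟦ lookup ys i ⟧ ρ ≡ ⟦ q x ys ⟧ (ρ [ x ↦ i ])
  arg-value {x} {ys} nf i ρ = begin
    ⟦ lookup ys i ⟧ ρ          ≡⟨ sym (Above⇒Invariant (normal⇒ArgsAbove _ nf i) ρ i) ⟩
    ⟦ lookup ys i ⟧ ρ′         ≡⟨ cong (λ j → ⟦ lookup ys j ⟧ ρ′) (sym ([↦]-same ρ x i)) ⟩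
    ⟦ lookup ys (ρ′ x) ⟧ ρ′    ≡⟨ sym (⟦q⟧ x ys ρ′) ⟩
    ⟦ q x ys ⟧ ρ′              ∎
    where
    ρ′ = ρ [ x ↦ i ]

  -- A normal q x ys cannot have the value of an x-invariant u if arguments with u's value
  -- equal u: all arguments would be u, an r2-redex.
  not-constant : ∀ {x ys u} → Normal (q x ys) → q x ys ≈ u → Invariant x u →
                 (∀ i → lookup ys i ≈ u → lookup ys i ≡ u) → ⊥
  not-constant {x} {ys} {u} nf q≈u invariant args≡ =
    nf (u , subst (λ vs → q x vs ↣ u) (sym ys≡u) (r2 x u))
    where
    ys≡u : ys ≡ replicate n u
    ys≡u = vec-ext ys _ λ i →
      trans (args≡ i λ ρ → trans (arg-value nf i ρ) (trans (q≈u _) (invariant ρ i)))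
            (sym (lookup-replicate i u))

  -- A normal q x ys cannot have the value of var x if arguments with the value of e i
  -- equal e i: the arguments would be e_1, …, e_n, an r3-redex.
  not-var : ∀ {x ys} → Normal (q x ys) → q x ys ≈ var x →
            (∀ i → lookup ys i ≈ e i → lookup ys i ≡ e i) → ⊥
  not-var {x} {ys} nf q≈x args≡ = nf (var x , subst (λ vs → q x vs ↣ var x) (sym ys≡e) (r3 x))
    where
    ys≡e : ys ≡ tabulate e
    ys≡e = vec-ext ys _ λ i →
      trans (args≡ i λ ρ → trans (arg-value nf i ρ) (trans (q≈x _) ([↦]-same ρ x i)))
            (sym (lookup∘tabulate e i))

-- Termination needs an index a : Fin n (for n = 0, r2 gives q x [] ↣ q x []).

module Termination {n : ℕ} (a : Fin n) where

  _≺ᵛ_ : Vec (HNF n) n → Vec (HNF n) n → Set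
  _≺ᵛ_ = OnePosition _≺_

  -- SN-q: q x ys is SN when all arguments are, by induction on x and then on ys under ≺ᵛ.
  SN-q       : ∀ {x} → Acc _<_ x → ∀ {ys} → Acc _≺ᵛ_ ys →
               (∀ i → SN (lookup ys i)) → SN (q x ys)
  SN-reduct  : ∀ {x} → Acc _<_ x → ∀ {ys} → WfRec _≺ᵛ_ (Acc _≺ᵛ_) ys →
               (∀ i → SN (lookup ys i)) → ∀ {t} → q x ys ↣ t → SN t
  SN-replace : ∀ {x} → Acc _<_ x → ∀ {ys} → WfRec _≺ᵛ_ (Acc _≺ᵛ_) ys →
               (∀ i → SN (lookup ys i)) → ∀ i {t} → t ≺ lookup ys i → SN t → SN (q x (ys [ i ]≔ t))
  SN-lower   : ∀ {x} → WfRec _<_ (Acc _<_) x → ∀ {x′} → x′ < x →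
               ∀ vs → (∀ j → SN (lookup vs j)) → SN (q x′ vs)

  SN-q acc-x (acc smaller) args = acc (SN-reduct acc-x smaller args)

  SN-replace acc-x {ys} smaller args i t≺yᵢ sn-t =
    SN-q acc-x (smaller (at ys i t≺yᵢ)) (update-∀ {P = SN} ys i args sn-t)

  SN-lower below x′<x vs args = SN-q (below x′<x) (onePosition-acc vs (SN⇒acc ∘ args)) args

  SN-reduct acc-x smaller args (r2 _ y) = subst SN (lookup-replicate a y) (args a)
  SN-reduct acc-x smaller args (r3 _)   = normal⇒SN var-normal
  SN-reduct acc-x smaller args (r4 x ys i yᵢ≡x) =
    SN-replace acc-x smaller args i (subst (e i ≺_) (sym yᵢ≡x) (e≺var i x)) (normal⇒SN e-normal)
  SN-reduct acc-x smaller args (r5 x ys zs i yᵢ≡q) =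
    SN-replace acc-x smaller args i (subst (lookup zs i ≺_) (sym yᵢ≡q) (arg x zs i))
               (SN-arg (subst SN yᵢ≡q (args i)) i)
  SN-reduct acc-x@(acc below) smaller args (r6 x x′ ys zs i x′<x yᵢ≡q) =
    SN-lower below x′<x _ λ j → subst SN (sym (lookup-map j _ zs))
      (SN-replace acc-x smaller args i (subst (lookup zs j ≺_) (sym yᵢ≡q) (arg x′ zs j))
                  (SN-arg (subst SN yᵢ≡q (args i)) j))
  SN-reduct acc-x@(acc below) smaller args (r7 x x′ ys i x′<x yᵢ≡x′) =
    SN-lower below x′<x _ λ j → subst SN (sym (lookup∘tabulate _ j))
      (SN-replace acc-x smaller args i (subst (e j ≺_) (sym yᵢ≡x′) (e≺var j x′)) (normal⇒SN e-normal))
  SN-reduct acc-x smaller args (cong-q x ys i step) =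
    SN-replace acc-x smaller args i (reduct step) (acc-inverse (args i) step)

  all-SN : ∀ t → SN t
  all-SN = hnf-ind SN (λ _ → normal⇒SN e-normal) (λ _ → normal⇒SN var-normal)
    λ x ys args → SN-q (<-wellFounded x) (onePosition-acc ys (SN⇒acc ∘ args)) args

  terminating : Terminating {n}
  terminating (f , steps) = SN⇒finite (all-SN (f 0)) f refl steps

-- Every SN term rewrites to a normal form; finding a redex uses a : Fin n for r2.

module Normalisation {n : ℕ} (a : Fin n) where

  constant-at-a : ∀ {ys : Vec (HNF n) n} {y} → ys ≡ replicate n y → ys ≡ replicate n (lookup ys a)
  constant-at-a {y = y} refl = cong (replicate n) (sym (lookup-replicate a y))

  reducible? : ∀ t → Dec (Reducible t)
  reducible? = hnf-ind (Dec ∘ Reducible) (λ _ → no e-normal) (λ _ → no var-normal) reducible?-q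
    where
    reducible?-q : ∀ x ys → (∀ i → Dec (Reducible (lookup ys i))) → Dec (Reducible (q x ys))
    reducible?-q x ys args? with any? args?
    ... | yes (i , _ , step) = yes (_ , cong-q x ys i step)
    ... | no ¬args with ≡-dec _≟_ ys (replicate n (lookup ys a))
    ...   | yes ys≡y = yes (_ , subst (λ vs → q x vs ↣ lookup ys a) (sym ys≡y) (r2 x _))
    ...   | no ¬const with ≡-dec _≟_ ys (tabulate e)
    ...     | yes ys≡e = yes (_ , subst (λ vs → q x vs ↣ var x) (sym ys≡e) (r3 x))
    ...     | no ¬tab with all? (λ i → headAbove? x (lookup ys i))
    ...       | yes above = no (normal-q x ys (λ i r → ¬args (i , r)) above
                                  (λ _ ys≡y → ¬const (constant-at-a ys≡y)) ¬tab)
    ...       | no ¬above =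
      yes (uncurry (λ i → redex x ys i refl) (¬∀⟶∃¬ n _ (λ i → headAbove? x (lookup ys i)) ¬above))

  normalise : ∀ {t} → SN t → ∃ λ u → t ↣* u × Normal u
  normalise {t} (acc reducts) with reducible? t
  ... | no nf          = t , ε , nf
  ... | yes (_ , step) = let u , steps , nf = normalise (reducts step) in u , step ◅ steps , nf

module Uniqueness {n : ℕ} {a b : Fin n} (a≢b : a ≢ b) where

  other : Fin n → Fin n
  other i with i ≟ᶠ a
  ... | yes _ = b
  ... | no _  = a

  other≢ : ∀ i → other i ≢ i
  other≢ i with i ≟ᶠ a
  ... | yes refl = a≢b ∘ sym
  ... | no i≢a   = i≢a ∘ sym

  e≈e : ∀ {i j} → e {n} i ≈ e j → i ≡ j
  e≈e i≈j = i≈j (λ _ → a)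

  e≉var : ∀ {i x} → ¬ (e {n} i ≈ var x)
  e≉var {i} i≈x = other≢ i (sym (i≈x (λ _ → other i)))

  var≈var : ∀ {x y} → var {n} x ≈ var y → x ≡ y
  var≈var {x} {y} x≈y with x ℕ.≟ y
  ... | yes x≡y = x≡y
  ... | no x≢y  = ⊥-elim (a≢b (begin
    a   ≡⟨ sym ([↦]-same ρ₀ x a) ⟩
    ρ x ≡⟨ x≈y ρ ⟩
    ρ y ≡⟨ [↦]-other ρ₀ x a (x≢y ∘ sym) ⟩
    b   ∎))
    where
    ρ₀ ρ : Env
    ρ₀ = λ _ → b
    ρ  = ρ₀ [ x ↦ a ]

  size  : HNF n → ℕ
  sizes : ∀ {k} → Vec (HNF n) k → ℕ
  size (e _)    = 1
  size (var _)  = 1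
  size (q _ ys) = suc (sizes ys)
  sizes []       = 0
  sizes (y ∷ ys) = size y + sizes ys

  size-arg : ∀ x ys i → size (lookup ys i) < size (q x ys)
  size-arg x ys i = s≤s (sizes-lookup ys i)
    where
    sizes-lookup : ∀ {k} (ys : Vec (HNF n) k) i → size (lookup ys i) ≤ sizes ys
    sizes-lookup (y ∷ ys) zero    = m≤m+n (size y) (sizes ys)
    sizes-lookup (y ∷ ys) (suc i) = ≤-trans (sizes-lookup ys i) (m≤n+m (sizes ys) (size y))

  shrink : ∀ {l′ l} k {F} → l′ < l → l + k ≤ F → l′ + k < F
  shrink k l′<l le = <-≤-trans (+-monoˡ-< k l′<l) le

  flip-bound : ∀ l k {F} → l + k ≤ F → k + l ≤ F
  flip-bound l k le = ≤-trans (≤-reflexive (+-comm k l)) le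

  -- Normal forms with the same value are equal; induction on F bounding the total size.
  -- q-unique handles a q-term on the left, args-unique is the hypothesis for its arguments.
  normal-unique : ∀ F {s t} → size s + size t < F → Normal s → Normal t → s ≈ t → s ≡ t
  q-unique      : ∀ F {x ys t} → size (q x ys) + size t ≤ F →
                  Normal (q x ys) → Normal t → q x ys ≈ t → q x ys ≡ t
  args-unique   : ∀ F {x ys u} → size (q x ys) + size u ≤ F → Normal (q x ys) → Normal u →
                  ∀ i → lookup ys i ≈ u → lookup ys i ≡ u

  normal-unique zero () _ _ _
  normal-unique (suc F) {e i}    {e j}    _ _ _ s≈t = cong e (e≈e s≈t)
  normal-unique (suc F) {e i}    {var y}  _ _ _ s≈t = ⊥-elim (e≉var s≈t)
  normal-unique (suc F) {var x}  {e j}    _ _ _ s≈t =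
    ⊥-elim (e≉var (≈-sym {s = var x} {t = e j} s≈t))
  normal-unique (suc F) {var x}  {var y}  _ _ _ s≈t = cong var (var≈var s≈t)
  normal-unique (suc F) {q x ys} (s≤s le) ns nt s≈t = q-unique F le ns nt s≈t
  normal-unique (suc F) {s} {q y zs} (s≤s le) ns nt s≈t =
    sym (q-unique F (flip-bound (size s) (size (q y zs)) le) nt ns
                  (≈-sym {s = s} {t = q y zs} s≈t))

  args-unique F {x} {ys} {u} le ns nu i =
    normal-unique F (shrink (size u) (size-arg x ys i) le) (arg-normal ns i) nu

  q-unique F {x} {ys} {e k} le ns nt q≈t =
    ⊥-elim (not-constant ns q≈t (λ _ _ → refl) (args-unique F le ns nt))
  q-unique F {x} {ys} {var y} le ns nt q≈t with y ℕ.≟ x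
  ... | yes refl = ⊥-elim (not-var ns q≈t λ i → args-unique F le ns e-normal i)
  ... | no y≢x   = ⊥-elim (not-constant ns q≈t (λ ρ i → [↦]-other ρ x i y≢x) (args-unique F le ns nt))
  q-unique F {x} {ys} {q y zs} le ns nt q≈t with <-cmp x y
  ... | tri< x<y _ _ =
    ⊥-elim (not-constant ns q≈t (Above⇒Invariant (normal⇒Above x<y nt)) (args-unique F le ns nt))
  ... | tri> _ _ y<x =
    ⊥-elim (not-constant nt (≈-sym {s = q x ys} {t = q y zs} q≈t)
                         (Above⇒Invariant (normal⇒Above y<x ns))
                         (args-unique F (flip-bound (size (q x ys)) (size (q y zs)) le) nt ns))
  ... | tri≈ _ refl _ = cong (q x) (vec-ext ys zs λ i →
    normal-unique F (<-≤-trans (+-mono-< (size-arg x ys i) (size-arg x zs i)) le)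
                  (arg-normal ns i) (arg-normal nt i)
                  λ ρ → trans (arg-value ns i ρ) (trans (q≈t _) (sym (arg-value nt i ρ))))

  normal-forms-unique : ∀ {s t} → Normal s → Normal t → s ≈ t → s ≡ t
  normal-forms-unique = normal-unique _ (n<1+n _)

module Confluence {n : ℕ} {a b : Fin n} (a≢b : a ≢ b) where
  open Termination a using (all-SN)
  open Normalisation a using (normalise)
  open Uniqueness a≢b using (normal-forms-unique)

  confluent : Confluent {n}
  confluent t u v t↣*u t↣*v =
    let u′ , u↣*u′ , normal-u′ = normalise (all-SN u)
        v′ , v↣*v′ , normal-v′ = normalise (all-SN v)
        u′≈v′ = reducts-≈ (t↣*u ◅◅ u↣*u′) (t↣*v ◅◅ v↣*v′)
    in  u′ , u↣*u′ , subst (v ↣*_) (sym (normal-forms-unique normal-u′ normal-v′ u′≈v′)) v↣*v′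

theorem7p12 : (n : ℕ) → 2 ≤ n → Terminating {n} × Confluent {n}
theorem7p12 (suc (suc m)) (s≤s (s≤s z≤n)) = terminating , confluent
  where
  open Termination {suc (suc m)} zero using (terminating)
  open Confluence {suc (suc m)} {zero} {suc zero} (λ ()) using (confluent)
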